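{- Let $G=([n],E)\sim{\sf G}(n,\tfrac12,k)$ with clique size $k$. Let $V_1$-Membership be the algorithm that returns $1$ for every vertex of $N_1$, and for $t\ge2$ let $V_t$-Membership$(G,k,t,v)$, for $v\in N_t$, be the algorithm that iterates over all $u\in N_{t-1}$, calls $V_{t-1}$-Membership$(G,k,t-1,u)$, and for those $u$ with answer $1$ increments a counter $\mathrm{size}V_{t-1}$ by $1$ and a counter $\mathrm{deg}V_{t-1}$ by $\mathbb 1_{(u,v)\in E}$; it then outputs $1$ if $\mathrm{deg}V_{t-1}\ge \frac{\mathrm{size}V_{t-1}}{2}+k_{t+2}-2\sqrt{\mathrm{size}V_{t-1}}$ and $0$ otherwise. Then for every $t\ge1$ and every $v\in N_t$, $V_t$-Membership$(G,k,t,v)$ returns $1$ if and only if $v\in V_t$ (and $0$ otherwise), and it runs in space $O(t\cdot\log n)$.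
   Context: Vertex set $[n]=\{1,\dots,n\}$ with its natural ordering; logarithms base 2. $n_0$ is the smallest power of 2 that is at least $n/2$, $k_0:=k n_0/n$; for integers $0<t<\log n_0$, $n_t:=n_0/2^t$, $k_t:=k_0/2^t$, $N_t:=[n_{t-1}]\setminus[n_t]$. Define $V_1:=N_1$ and for $t>1$, $V_t:=\{v\in N_t:\sum_{u\in V_{t-1}}\mathbb 1_{(u,v)\in E}\ge \frac{|V_{t-1}|}{2}+k_{t+2}-2\sqrt{|V_{t-1}|}\}$. Model of computation: deterministic space-bounded computation with read-only random-access input (adjacency matrix of $G$ and $k$; also $t$ and $v$), working space counted in bits, write-only output; arithmetic on $O(\log n)$-bit numbers (including square roots to the needed precision) uses $O(\log n)$ space. -}

module Defs where

open import Data.Nat using (ℕ; zero; suc; _+_; _*_; _∸_; _^_; _≤_; _<_; _<?_; _≤?_; NonZero)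
open import Data.Nat.Properties using (m*n≢0; m^n≢0)
open import Data.Nat.Logarithm using (⌈log₂_⌉)
open import Data.Bool using (Bool; true; false; _∧_; if_then_else_)
open import Data.Maybe using (Maybe; just; nothing)
open import Data.List using (List; []; _∷_; length; filter; filterᵇ; applyUpTo; map)
open import Data.Nat.ListAction using (sum)
open import Data.List.Relation.Unary.All using (All)
open import Data.List.Relation.Unary.AllPairs using (AllPairs)
open import Data.Integer using (+_)
open import Data.Rational using (ℚ; 0ℚ) renaming (_/_ to _÷_; _+_ to _+ℚ_; _-_ to _-ℚ_; _*_ to _*ℚ_; _≤_ to _≤ℚ_; _≤?_ to _≤ℚ?_)
open import Data.Product using (Σ-syntax; _×_)
open import Data.Sum using (_⊎_)
open import Relation.Nullary using (Dec; does; yes; no)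
open import Relation.Nullary.Decidable using (_⊎-dec_)
open import Relation.Binary.PropositionalEquality using (_≡_; _≢_)

-- Graphs on the vertex set [n] = {1,…,n}: adjacency given by a Boolean
-- function (only the values on [n] × [n] matter).

SimpleGraph : (ℕ → ℕ → Bool) → Set
SimpleGraph G = (∀ u w → G u w ≡ G w u) × (∀ u → G u u ≡ false)

-- Support of G(n,1/2,k): G contains a clique on k distinct vertices of [n].
HasClique : ℕ → ℕ → (ℕ → ℕ → Bool) → Set
HasClique n k G =
  Σ[ S ∈ List ℕ ] (length S ≡ k × All (λ u → 1 ≤ u × u ≤ n) S
                   × AllPairs (λ u w → u ≢ w × G u w ≡ true) S)

-- e = log n₀ where n₀ = 2^e is the smallest power of 2 with n₀ ≥ n/2.
IsLogN0 : ℕ → ℕ → Set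
IsLogN0 n e = (n ≤ 2 * 2 ^ e) × (∀ e′ → e′ < e → 2 * 2 ^ e′ < n)

nₜ : (e t : ℕ) → ℕ
nₜ e t = 2 ^ (e ∸ t)

-- N_t = [n_{t-1}] ∖ [n_t], listed in increasing order
Nₜ : (e t : ℕ) → List ℕ
Nₜ e t = filter (λ v → nₜ e t <? v) (applyUpTo suc (nₜ e (t ∸ 1)))

module _ (n k e : ℕ) .{{nz : NonZero n}} (G : ℕ → ℕ → Bool) where

  -- k_t = k₀ / 2^t with k₀ = k n₀ / n   (a rational number)
  kₜ : ℕ → ℚ
  kₜ t = _÷_ (+ (k * 2 ^ e)) (n * 2 ^ t) {{m*n≢0 n (2 ^ t) {{nz}} {{m^n≢0 2 t}}}}

  -- Threshold condition  d ≥ s/2 + k_{T+2} − 2√s  (real numbers).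
  -- With a := s/2 + k_{T+2} − d this reads a ≤ 2√s, which for real a and
  -- s ≥ 0 holds iff a ≤ 0 or a² ≤ 4s.
  Threshold : (d s T : ℕ) → Set
  Threshold d s T = (a ≤ℚ 0ℚ) ⊎ (a *ℚ a ≤ℚ (+ (4 * s) ÷ 1))
    where a = ((+ s ÷ 2) +ℚ kₜ (T + 2)) -ℚ (+ d ÷ 1)

  threshold? : (d s T : ℕ) → Dec (Threshold d s T)
  threshold? d s T = (_ ≤ℚ? _) ⊎-dec (_ ≤ℚ? _)

  nextV : (T : ℕ) → List ℕ → List ℕ
  nextV T prev = filter (λ v → threshold? (degIn v) (length prev) T) (Nₜ e T)
    where
      degIn : ℕ → ℕ
      degIn v = length (filterᵇ (λ u → G u v) prev)

  V : ℕ → List ℕ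
  V zero = []
  V (suc zero) = Nₜ e 1
  V (suc (suc t)) = nextV (suc (suc t)) (V (suc t))

  -- The recursive algorithm V_t-Membership as a deterministic stack
  -- machine.  Each stack frame is one active call V_L-Membership(G,k,L,v)
  -- with its working registers: the level L, the vertex v, the loop
  -- variable u (cur), and the counters sizeV_{L-1} and degV_{L-1}.
  -- The input (G, k, n) is read-only and not counted as space.

  record Frame : Set where
    constructor frame
    field
      lvl vtx cur size deg : ℕ

  data Config : Set where
    running : List Frame → Maybe Bool → Config   -- call stack, return register
    halted  : Bool → Config

  private
    return : List Frame → Bool → Config
    return [] b = halted b
    return (f ∷ fs) b = running (f ∷ fs) (just b)

  step : Config → Config
  step (halted b) = halted b
  step (running [] r) = halted false
  step (running (frame L v c s d ∷ fs) r) with L ≤? 1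
  ... | yes _ = return fs true
  ... | no _ with r
  ...   | just b =                               -- answer for u = c received
          running (frame L v (suc c) (s + (if b then 1 else 0))
                           (d + (if b ∧ G c v then 1 else 0)) ∷ fs) nothing
  ...   | nothing with c ≤? nₜ e (L ∸ 2)
  ...     | yes _ =                              -- call V_{L-1}-Membership(u = c)
            running (frame (L ∸ 1) c (suc (nₜ e (L ∸ 2))) 0 0 ∷ frame L v c s d ∷ fs) nothing
  ...     | no _ = return fs (does (threshold? d s L))   -- loop over N_{L-1} done

  run : ℕ → Config → Config
  run zero c = c
  run (suc i) c = run i (step c)

  init : (t v : ℕ) → Config
  init t v = running (frame t v (suc (nₜ e (t ∸ 1))) 0 0 ∷ []) nothing

bits : ℕ → ℕ
bits x = ⌈log₂ (suc x) ⌉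

frameSpace : ∀ {n k e} .{{_ : NonZero n}} {G} → Frame n k e G → ℕ
frameSpace (frame L v c s d) = 1 + bits L + bits v + bits c + bits s + bits d

space : ∀ {n k e} .{{_ : NonZero n}} {G} → Config n k e G → ℕ
space (running fs r) = 2 + sum (map frameSpace fs)
space (halted b) = 1

-- A call at level L ≥ 2 scans N_{L-1} = (n_{L-1}, n_{L-2}] in increasing
-- order, calling level L-1 on each u, so by induction on L it computes the
-- Boolean function `member L`, and filtering N_L by `member L` is exactly the
-- recursive definition of V_L.  For space, every register holds a number at
-- most 2^e + 1 ≤ n, so a frame costs O(log n) bits, and a call at level L
-- never pushes more than L frames above the stack it was called from.
module Submission where

open import Defs
open import Data.Nat using (ℕ; zero; suc; _+_; _*_; _∸_; _^_; _≤_; _<_; _<?_; _≤?_; z≤n; s≤s; z<s; NonZero; >-nonZero)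
open import Data.Nat.Properties
open import Algebra.Properties.CommutativeSemigroup +-commutativeSemigroup using (x∙yz≈y∙xz)
open import Data.Nat.Logarithm using (⌈log₂_⌉; ⌈log₂⌉-mono-≤; ⌈log₂2*n⌉≡1+⌈log₂n⌉)
open import Data.Nat.Solver using (module +-*-Solver)
open import Data.Bool using (Bool; true; false; T?; _∧_; if_then_else_)
open import Data.Bool.Properties using (T-≡)
open import Data.Maybe using (just; nothing)
open import Data.List using (List; []; _∷_; _++_; length; filter; filterᵇ; applyUpTo; map)
open import Data.Nat.ListAction using (sum)
open import Data.List.Properties using (filter-++; filter-all; filter-none)
import Data.List.Relation.Unary.All as All
open import Data.List.Relation.Unary.Any using (here; there)
open import Data.List.Membership.Propositional using (_∈_)
open import Data.List.Membership.Propositional.Properties using (∈-filter⁺; ∈-filter⁻)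
open import Data.Product using (∃-syntax; Σ-syntax; _×_; _,_; proj₁; proj₂)
open import Function.Base using (_∘_; _$_)
open import Function.Bundles using (_⇔_; mk⇔; Equivalence)
open import Relation.Binary.PropositionalEquality
  using (_≡_; refl; sym; trans; cong; cong₂; subst; module ≡-Reasoning)
open import Relation.Nullary using (¬_; yes; no; does; contradiction)
open import Relation.Unary using (Decidable)

n<2^n : ∀ n → n < 2 ^ n
n<2^n zero    = s≤s z≤n
n<2^n (suc n) = begin-strict
  suc n          ≡⟨ +-comm 1 n ⟩
  n + 1          <⟨ +-mono-<-≤ (n<2^n n) (m^n>0 2 n) ⟩
  2 ^ n + 2 ^ n  ≡⟨ cong (2 ^ n +_) (sym (+-identityʳ (2 ^ n))) ⟩
  2 ^ suc n      ∎
  where open ≤-Reasoning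

bits≤1+⌈log₂⌉ : ∀ {x n} → 1 ≤ n → x ≤ n → bits x ≤ suc ⌈log₂ n ⌉
bits≤1+⌈log₂⌉ {x} {n} 1≤n x≤n = begin
  ⌈log₂ suc x ⌉     ≤⟨ ⌈log₂⌉-mono-≤ (+-mono-≤ 1≤n x≤n) ⟩
  ⌈log₂ n + n ⌉     ≡⟨ cong (λ m → ⌈log₂ n + m ⌉) (sym (+-identityʳ n)) ⟩
  ⌈log₂ 2 * n ⌉     ≡⟨ ⌈log₂2*n⌉≡1+⌈log₂n⌉ n {{>-nonZero 1≤n}} ⟩
  suc ⌈log₂ n ⌉     ∎
  where open ≤-Reasoning

m+[n+1]≡1+m+n : ∀ m n → m + (n + 1) ≡ suc (m + n)
m+[n+1]≡1+m+n m n = trans (cong (m +_) (+-comm n 1)) (+-suc m n)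

if-≤1 : ∀ b → (if b then 1 else 0) ≤ 1
if-≤1 true  = ≤-refl
if-≤1 false = z≤n

if-∧-≤ : ∀ b g → (if b ∧ g then 1 else 0) ≤ (if b then 1 else 0)
if-∧-≤ true  true  = ≤-refl
if-∧-≤ true  false = z≤n
if-∧-≤ false _     = z≤n

filter≡filterᵇ : ∀ {A : Set} {P : A → Set} (P? : Decidable P) xs →
                 filter P? xs ≡ filterᵇ (does ∘ P?) xs
filter≡filterᵇ P? []       = refl
filter≡filterᵇ P? (x ∷ xs) with does (P? x)
... | true  = cong (x ∷_) (filter≡filterᵇ P? xs)
... | false = filter≡filterᵇ P? xs

filterᵇ-true : ∀ {A : Set} (xs : List A) → filterᵇ (λ _ → true) xs ≡ xs
filterᵇ-true xs = filter-all (T? ∘ λ _ → true) (All.universal _ xs)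

∈-filterᵇ : ∀ {A : Set} (p : A → Bool) {x : A} {xs} → x ∈ xs →
            (p x ≡ true) ⇔ (x ∈ filterᵇ p xs)
∈-filterᵇ p {xs = xs} x∈xs = mk⇔ (λ px → ∈-filter⁺ (T? ∘ p) x∈xs (Equivalence.from T-≡ px))
                       (λ x∈ → Equivalence.to T-≡ (proj₂ (∈-filter⁻ (T? ∘ p) {xs = xs} x∈)))

range : ℕ → ℕ → List ℕ
range c zero    = []
range c (suc m) = c ∷ range (suc c) m

∈-range⁻ : ∀ {x} c m → x ∈ range c m → c ≤ x × x < c + m
∈-range⁻ c (suc m) (here refl) = ≤-refl , m<m+n c z<s
∈-range⁻ {x} c (suc m) (there x∈) with c<x , x< ← ∈-range⁻ (suc c) m x∈ =
  <⇒≤ c<x , subst (x <_) (sym (+-suc c m)) x<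

range-++ : ∀ c m m′ → range c (m + m′) ≡ range c m ++ range (c + m) m′
range-++ c zero    m′ = cong (λ c′ → range c′ m′) (sym (+-identityʳ c))
range-++ c (suc m) m′ = cong (c ∷_) (trans (range-++ (suc c) m m′)
                                         (cong (λ c′ → range (suc c) m ++ range c′ m′) (sym (+-suc c m))))

applyUpTo-range : ∀ {f : ℕ → ℕ} c m → (∀ i → f i ≡ c + i) → applyUpTo f m ≡ range c m
applyUpTo-range c zero    f≗ = refl
applyUpTo-range c (suc m) f≗ = cong₂ _∷_ (trans (f≗ 0) (+-identityʳ c))
                                         (applyUpTo-range (suc c) m (λ i → trans (f≗ (suc i)) (+-suc c i)))

filter->-range : ∀ a b → a ≤ b → filter (a <?_) (range 1 b) ≡ range (suc a) (b ∸ a)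
filter->-range a b a≤b = begin
  filter (a <?_) (range 1 b)
    ≡⟨ cong (filter (a <?_) ∘ range 1) (sym (m+[n∸m]≡n a≤b)) ⟩
  filter (a <?_) (range 1 (a + (b ∸ a)))
    ≡⟨ cong (filter (a <?_)) (range-++ 1 a (b ∸ a)) ⟩
  filter (a <?_) (range 1 a ++ range (suc a) (b ∸ a))
    ≡⟨ filter-++ (a <?_) (range 1 a) _ ⟩
  filter (a <?_) (range 1 a) ++ filter (a <?_) (range (suc a) (b ∸ a))
    ≡⟨ cong₂ _++_ (filter-none (a <?_) (All.tabulate (≤⇒≯ ∘ ≤-pred ∘ proj₂ ∘ ∈-range⁻ 1 a)))
                  (filter-all (a <?_) (All.tabulate (proj₁ ∘ ∈-range⁻ (suc a) (b ∸ a)))) ⟩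
  range (suc a) (b ∸ a) ∎
  where open ≡-Reasoning

nₜ-suc≤ : ∀ e t → nₜ e (suc t) ≤ nₜ e t
nₜ-suc≤ e t = ^-monoʳ-≤ 2 (∸-monoʳ-≤ e (n≤1+n t))

nₜ≤2^e : ∀ e t → nₜ e t ≤ 2 ^ e
nₜ≤2^e e t = ^-monoʳ-≤ 2 (m∸n≤m e t)

Nₜ-range : ∀ e t → Nₜ e (suc t) ≡ range (suc (nₜ e (suc t))) (nₜ e t ∸ nₜ e (suc t))
Nₜ-range e t = trans (cong (filter _) (applyUpTo-range 1 (nₜ e t) (λ _ → refl)))
                     (filter->-range (nₜ e (suc t)) (nₜ e t) (nₜ-suc≤ e t))

∈Nₜ⇒≤nₜ : ∀ {e t v} → v ∈ Nₜ e (suc t) → v ≤ nₜ e t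
∈Nₜ⇒≤nₜ {e} {t} {v} v∈ = ≤-pred (subst (v <_) (cong suc (m+[n∸m]≡n (nₜ-suc≤ e t)))
  (proj₂ (∈-range⁻ _ _ (subst (_ ∈_) (Nₜ-range e t) v∈))))

module Membership (n k e : ℕ) .{{_ : NonZero n}} (G : ℕ → ℕ → Bool) where

  threshold : ℕ → ℕ → ℕ → Bool
  threshold d s T = does (threshold? n k e G d s T)

  degIn : ℕ → List ℕ → ℕ
  degIn v us = length (filterᵇ (λ u → G u v) us)

  inNextV : ℕ → List ℕ → ℕ → Bool
  inNextV T prev v = threshold (degIn v prev) (length prev) T

  member : ℕ → ℕ → Bool
  member zero          _ = true
  member (suc zero)    _ = true
  member (suc (suc L))   = inNextV (suc (suc L)) (filterᵇ (member (suc L)) (Nₜ e (suc L)))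

  V≡filter-member : ∀ L → V n k e G (suc L) ≡ filterᵇ (member (suc L)) (Nₜ e (suc L))
  V≡filter-member zero    = sym (filterᵇ-true (Nₜ e 1))
  V≡filter-member (suc L) = trans (filter≡filterᵇ _ (Nₜ e (suc (suc L))))
    (cong (λ W → filterᵇ (inNextV (suc (suc L)) W) (Nₜ e (suc (suc L)))) (V≡filter-member L))

  tally : ∀ (p : ℕ → Bool) v x xs s d →
          length (filterᵇ p xs) + (s + (if p x then 1 else 0)) ≡ length (filterᵇ p (x ∷ xs)) + s
          × degIn v (filterᵇ p xs) + (d + (if p x ∧ G x v then 1 else 0)) ≡ degIn v (filterᵇ p (x ∷ xs)) + d
  tally p v x xs s d with p x
  ... | false = cong (_ +_) (+-identityʳ s) , cong (_ +_) (+-identityʳ d)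
  ... | true with G x v
  ...   | false = m+[n+1]≡1+m+n _ s , cong (_ +_) (+-identityʳ d)
  ...   | true  = m+[n+1]≡1+m+n _ s , m+[n+1]≡1+m+n _ d

  member-by-range : ∀ L v →
    let S = filterᵇ (member (suc L)) (range (suc (nₜ e (suc L))) (nₜ e L ∸ nₜ e (suc L))) in
    threshold (degIn v S + 0) (length S + 0) (suc (suc L)) ≡ member (suc (suc L)) v
  member-by-range L v = begin
    threshold (degIn v S + 0) (length S + 0) (suc (suc L))
      ≡⟨ cong₂ (λ d s → threshold d s (suc (suc L))) (+-identityʳ (degIn v S)) (+-identityʳ (length S)) ⟩
    inNextV (suc (suc L)) S v
      ≡⟨ cong (λ xs → inNextV (suc (suc L)) (filterᵇ (member (suc L)) xs) v) (sym (Nₜ-range e L)) ⟩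
    member (suc (suc L)) v ∎
    where
      open ≡-Reasoning
      S = filterᵇ (member (suc L)) (range (suc (nₜ e (suc L))) (nₜ e L ∸ nₜ e (suc L)))

  Stack : Set
  Stack = List (Frame n k e G)

  returning : Stack → Bool → Config n k e G
  returning []       b = halted b
  returning (f ∷ fs) b = running (f ∷ fs) (just b)

  data Reach (B : ℕ) : Config n k e G → Config n k e G → Set where
    stop : ∀ {c} → space c ≤ B → Reach B c c
    move : ∀ {c c′ c″} → step n k e G c ≡ c′ → space c ≤ B → Reach B c′ c″ → Reach B c c″

  reach-trans : ∀ {B c₁ c₂ c₃} → Reach B c₁ c₂ → Reach B c₂ c₃ → Reach B c₁ c₃
  reach-trans (stop _)          r′ = r′
  reach-trans (move step≡ sp r) r′ = move step≡ sp (reach-trans r r′)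

  reach-weaken : ∀ {B B′ c c′} → B ≤ B′ → Reach B c c′ → Reach B′ c c′
  reach-weaken B≤B′ (stop sp)         = stop (≤-trans sp B≤B′)
  reach-weaken B≤B′ (move step≡ sp r) = move step≡ (≤-trans sp B≤B′) (reach-weaken B≤B′ r)

  reach⇒run : ∀ {B c c′} → Reach B c c′ →
              Σ[ s ∈ ℕ ] (run n k e G s c ≡ c′ × (∀ i → i ≤ s → space (run n k e G i c) ≤ B))
  reach⇒run (stop sp) = 0 , refl , λ { zero _ → sp }
  reach⇒run (move refl sp r) with s , ends , bounded ← reach⇒run r =
    suc s , ends , λ { zero _ → sp ; (suc i) i≤ → bounded i (≤-pred i≤) }

  step-leaf : ∀ v c s d fs r → step n k e G (running (frame 1 v c s d ∷ fs) r) ≡ returning fs true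
  step-leaf v c s d []      r = refl
  step-leaf v c s d (_ ∷ _) r = refl

  step-call : ∀ L v c s d fs → c ≤ nₜ e L →
    step n k e G (running (frame (suc (suc L)) v c s d ∷ fs) nothing)
      ≡ running (frame (suc L) c (suc (nₜ e L)) 0 0 ∷ frame (suc (suc L)) v c s d ∷ fs) nothing
  step-call L v c s d fs c≤ with c ≤? nₜ e L
  ... | yes _  = refl
  ... | no c≰ = contradiction c≤ c≰

  step-finish : ∀ L v c s d fs → ¬ c ≤ nₜ e L →
    step n k e G (running (frame (suc (suc L)) v c s d ∷ fs) nothing)
      ≡ returning fs (threshold d s (suc (suc L)))
  step-finish L v c s d fs c≰ with c ≤? nₜ e L
  ... | yes c≤ = contradiction c≤ c≰
  step-finish L v c s d []      c≰ | no _ = refl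
  step-finish L v c s d (_ ∷ _) c≰ | no _ = refl

  module Budget (W : ℕ) (bits≤W : ∀ x → x ≤ suc (2 ^ e) → bits x ≤ W) where

    M : ℕ
    M = suc (2 ^ e)

    F : ℕ
    F = 1 + W + W + W + W + W

    frameSpace≤F : ∀ {L v c s d} → L ≤ M → v ≤ M → c ≤ M → s ≤ c → d ≤ s →
                   frameSpace (frame {n} {k} {e} {G} L v c s d) ≤ F
    frameSpace≤F {L} {v} {c} {s} {d} L≤M v≤M c≤M s≤c d≤s =
      +-mono-≤ (+-mono-≤ (+-mono-≤ (+-mono-≤ (+-monoʳ-≤ 1 (bits≤W L L≤M)) (bits≤W v v≤M))
                                   (bits≤W c c≤M)) (bits≤W s s≤M)) (bits≤W d (≤-trans d≤s s≤M))
      where s≤M = ≤-trans s≤c c≤M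

    budget : ℕ → Stack → ℕ
    budget h fs = h * F + space (running fs nothing)

    space-push : ∀ (f : Frame n k e G) fs r → frameSpace f ≤ F →
                 space (running (f ∷ fs) r) ≤ F + space (running fs r)
    space-push f fs r f≤F = begin
      2 + (frameSpace f + rest)  ≡⟨ sym (trans (+-suc (frameSpace f) (suc rest)) (cong suc (+-suc (frameSpace f) rest))) ⟩
      frameSpace f + (2 + rest)  ≤⟨ +-monoˡ-≤ (2 + rest) f≤F ⟩
      F + (2 + rest)             ∎
      where
        open ≤-Reasoning
        rest = sum (map frameSpace fs)

    space-top : ∀ (f : Frame n k e G) h fs r → frameSpace f ≤ F →
                space (running (f ∷ fs) r) ≤ budget (suc h) fs
    space-top f h fs r f≤F = begin
      space (running (f ∷ fs) r)       ≤⟨ space-push f fs r f≤F ⟩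
      F + space (running fs nothing)   ≤⟨ +-monoˡ-≤ _ (m≤m+n F (h * F)) ⟩
      budget (suc h) fs                ∎
      where open ≤-Reasoning

    budget-push : ∀ (f : Frame n k e G) h fs → frameSpace f ≤ F → budget h (f ∷ fs) ≤ budget (suc h) fs
    budget-push f h fs f≤F = begin
      h * F + space (running (f ∷ fs) nothing)  ≤⟨ +-monoʳ-≤ (h * F) (space-push f fs nothing f≤F) ⟩
      h * F + (F + space (running fs nothing))  ≡⟨ x∙yz≈y∙xz (h * F) F _ ⟩
      F + (h * F + space (running fs nothing))  ≡⟨ sym (+-assoc F (h * F) _) ⟩
      budget (suc h) fs                          ∎
      where open ≤-Reasoning

    space-returning : ∀ h fs b → space (returning fs b) ≤ budget h fs
    space-returning h []      b = ≤-trans (s≤s z≤n) (m≤n+m 2 (h * F))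
    space-returning h (_ ∷ _) b = m≤n+m _ (h * F)

    cur≤M : ∀ {c m} L → c + m ≡ suc (nₜ e L) → c ≤ M
    cur≤M {c} {m} L c+m≡ = ≤-trans (m≤m+n c m) (≤-trans (≤-reflexive c+m≡) (s≤s (nₜ≤2^e e L)))

    Call : ℕ → Set
    Call L = ∀ {u fs} → u ≤ M →
      Reach (budget (suc L) fs) (running (frame (suc L) u (suc (nₜ e L)) 0 0 ∷ fs) nothing)
                                (returning fs (member (suc L) u))

    loop : ∀ {L v fs} → suc (suc L) ≤ M → v ≤ M → Call L →
           ∀ c m s d → c + m ≡ suc (nₜ e L) → s ≤ c → d ≤ s →
           let S = filterᵇ (member (suc L)) (range c m) in
           Reach (budget (suc (suc L)) fs)
                 (running (frame (suc (suc L)) v c s d ∷ fs) nothing)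
                 (returning fs (threshold (degIn v S + d) (length S + s) (suc (suc L))))
    loop {L} {v} {fs} L≤M v≤M child c zero s d c+0≡ s≤c d≤s =
      move (step-finish L v c s d fs (<⇒≱ (≤-reflexive (sym c≡))))
           (space-top (frame (suc (suc L)) v c s d) (suc L) fs nothing
                      (frameSpace≤F L≤M v≤M (cur≤M L c+0≡) s≤c d≤s))
           (stop (space-returning (suc (suc L)) fs _))
      where
        c≡ : c ≡ suc (nₜ e L)
        c≡ = trans (sym (+-identityʳ c)) c+0≡
    loop {L} {v} {fs} L≤M v≤M child c (suc m) s d c+m≡ s≤c d≤s =
      move (step-call L v c s d fs c≤nₜ) (space-top top (suc L) fs nothing top≤F) $
      reach-trans (reach-weaken (budget-push top (suc L) fs top≤F) (child (cur≤M L c+m≡))) $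
      move refl (space-top top (suc L) fs (just b) top≤F) $
      subst (Reach _ _) (cong₂ (λ d s → returning fs (threshold d s (suc (suc L)))) deg≡ size≡)
        (loop L≤M v≤M child (suc c) m s′ d′ 1+c+m≡ s′≤1+c (+-mono-≤ d≤s (if-∧-≤ b (G c v))))
      where
        top = frame (suc (suc L)) v c s d
        top≤F = frameSpace≤F L≤M v≤M (cur≤M L c+m≡) s≤c d≤s
        b = member (suc L) c
        s′ = s + (if b then 1 else 0)
        d′ = d + (if b ∧ G c v then 1 else 0)
        1+c+m≡ : suc c + m ≡ suc (nₜ e L)
        1+c+m≡ = trans (sym (+-suc c m)) c+m≡
        c≤nₜ : c ≤ nₜ e L
        c≤nₜ = ≤-trans (m≤m+n c m) (≤-reflexive (suc-injective 1+c+m≡))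
        s′≤1+c : s′ ≤ suc c
        s′≤1+c = ≤-trans (+-mono-≤ s≤c (if-≤1 b)) (≤-reflexive (+-comm c 1))
        size≡ = proj₁ (tally (member (suc L)) v c (range (suc c) m) s d)
        deg≡  = proj₂ (tally (member (suc L)) v c (range (suc c) m) s d)

    call : ∀ L → suc L ≤ M → Call L
    call zero    L≤M {u} {fs} u≤M =
      move (step-leaf u (suc (nₜ e 0)) 0 0 fs nothing)
           (space-top (frame 1 u (suc (nₜ e 0)) 0 0) 0 fs nothing
                      (frameSpace≤F L≤M u≤M (s≤s (nₜ≤2^e e 0)) z≤n z≤n))
           (stop (space-returning 1 fs true))
    call (suc L) L≤M {u} {fs} u≤M =
      subst (λ b → Reach _ _ (returning fs b)) (member-by-range L u)
        (loop L≤M u≤M (call L (≤-trans (n≤1+n _) L≤M))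
              (suc (nₜ e (suc L))) (nₜ e L ∸ nₜ e (suc L)) 0 0
              (cong suc (m+[n∸m]≡n (nₜ-suc≤ e L))) z≤n z≤n)

space-bound : ∀ t w → suc t * (1 + suc w + suc w + suc w + suc w + suc w) + 2 ≤ 8 * suc t * suc w
space-bound t w = subst (suc t * (1 + suc w + suc w + suc w + suc w + suc w) + 2 ≤_) (slack t w)
                        (m≤m+n _ (3 * w + 2 * t + 3 * (t * w)))
  where
    open +-*-Solver
    slack : ∀ t w → suc t * (1 + suc w + suc w + suc w + suc w + suc w) + 2 + (3 * w + 2 * t + 3 * (t * w))
                    ≡ 8 * suc t * suc w
    slack = solve 2 (λ t w →
      (con 1 :+ t) :* (con 1 :+ (con 1 :+ w) :+ (con 1 :+ w) :+ (con 1 :+ w) :+ (con 1 :+ w) :+ (con 1 :+ w))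
        :+ con 2 :+ (con 3 :* w :+ con 2 :* t :+ con 3 :* (t :* w))
      := con 8 :* (con 1 :+ t) :* (con 1 :+ w)) refl

lemma3 : ∃[ C ] ∀ (n k : ℕ) .{{_ : NonZero n}} (G : ℕ → ℕ → Bool)
           → SimpleGraph G → HasClique n k G
           → (e : ℕ) → IsLogN0 n e
           → (t : ℕ) → 1 ≤ t → t < e
           → (v : ℕ) → v ∈ Nₜ e t
           → Σ[ s ∈ ℕ ] Σ[ b ∈ Bool ]
               (run n k e G s (init n k e G t v) ≡ halted b)
               × ((b ≡ true) ⇔ (v ∈ V n k e G t))
               × (∀ i → i ≤ s → space (run n k e G i (init n k e G t v)) ≤ C * t * suc ⌈log₂ n ⌉)
lemma3 .proj₁ = 8
lemma3 .proj₂ n k G _ _ (suc e) (_ , 2^<n) (suc t) _ t<e v v∈ =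
  proj₁ trace , member (suc t) v , proj₁ (proj₂ trace) , iff ,
  λ i i≤ → ≤-trans (proj₂ (proj₂ trace) i i≤) (space-bound t ⌈log₂ n ⌉)
  where
    M≤n : suc (2 ^ suc e) ≤ n
    M≤n = 2^<n e ≤-refl
    bits≤ : ∀ x → x ≤ suc (2 ^ suc e) → bits x ≤ suc ⌈log₂ n ⌉
    bits≤ x x≤M = bits≤1+⌈log₂⌉ (≤-trans (s≤s z≤n) M≤n) (≤-trans x≤M M≤n)
    open Membership n k (suc e) G
    open Budget (suc ⌈log₂ n ⌉) bits≤
    level≤M : suc t ≤ M
    level≤M = ≤-trans (<⇒≤ t<e) (≤-trans (<⇒≤ (n<2^n (suc e))) (n≤1+n _))
    v≤M : v ≤ M
    v≤M = ≤-trans (∈Nₜ⇒≤nₜ {suc e} {t} v∈) (≤-trans (nₜ≤2^e (suc e) t) (n≤1+n _))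
    trace = reach⇒run (call t level≤M v≤M)
    iff : (member (suc t) v ≡ true) ⇔ (v ∈ V n k (suc e) G (suc t))
    iff = subst (λ W → (member (suc t) v ≡ true) ⇔ (v ∈ W)) (sym (V≡filter-member t))
                (∈-filterᵇ (member (suc t)) v∈)
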